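{- Let $H=(A,B,E)$ be a bipartite graph in which every vertex of $B$ has degree at most $\Delta$ (where $\Delta\ge1$). Let $G=(A',B',E')$ be a bipartite graph in which every vertex of $A'$ has degree at least $(1-1/(2\Delta))|B'|$, and suppose $|B'|\ge 2|B|$. Then every injection $\phi:A\to A'$ extends to an injective map $\psi:A\cup B\to A'\cup B'$ with $\psi(B)\subseteq B'$ that is a graph homomorphism from $H$ to $G$ (i.e. $\psi(a)\psi(b)\in E'$ whenever $ab\in E$).
   Context: A bipartite graph $(A,B,E)$ has vertex set $A\cup B$ (disjoint) and edge set $E\subseteq A\times B$. -}

module Defs where

open import Data.Nat using (ℕ; _+_; _*_; _∸_; _≤_)
open import Data.Fin using (Fin)
open import Data.Bool using (Bool; true; false)
open import Data.Sum using (_⊎_; inj₁; inj₂)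
open import Data.List using (List; length; filter)
open import Data.List.Base using (allFin)
open import Data.Bool using (T)
open import Relation.Nullary.Decidable using (T?)

-- A finite bipartite graph (A,B,E): A = Fin nA, B = Fin nB (disjoint copies,
-- the vertex set is A ⊎ B), E ⊆ A × B given by a Boolean adjacency function.
record BipGraph : Set where
  field
    nA  : ℕ
    nB  : ℕ
    adj : Fin nA → Fin nB → Bool

open BipGraph public

Vertex : BipGraph → Set
Vertex G = Fin (nA G) ⊎ Fin (nB G)

degB : (G : BipGraph) → Fin (nB G) → ℕ
degB G b = length (filter (λ a → T? (adj G a b)) (allFin (nA G)))

degA : (G : BipGraph) → Fin (nA G) → ℕ
degA G a = length (filter (λ b → T? (adj G a b)) (allFin (nB G)))

module Submission where

-- Keep φ on A and map every b ∈ B to a vertex of B'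
-- adjacent to all of φ(N(b)).  Call y ∈ B' a *conflict* for b if some
-- neighbour a of b has φ(a)y ∉ E'.  Every a' ∈ A' misses at most |B'|/(2Δ)
-- vertices of B', and b has at most Δ neighbours, so by the union bound b has
-- at most |B'|/2 conflicts, hence at least |B'|/2 ≥ |B| candidates.  A family
-- of |B| candidate sets, each of size ≥ |B|, has a system of distinct
-- representatives (greedy Hall), which gives the injective images of B.

open import Defs
open import Data.Nat using (ℕ; zero; suc; _+_; _*_; _∸_; _≤_; _<_; z≤n; s≤s; NonZero; >-nonZero)
open import Data.Nat.Properties
open import Algebra.Properties.Semiring.Sum +-*-semiring
  using (sum; sum-syntax; sum-cong-≗; sum-remove; ∑-distrib-+; ∑-comm)
open import Data.Fin using (Fin; zero; suc; punchIn)
open import Data.Fin.Properties using (punchIn-injective; punchInᵢ≢i)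
open import Data.Bool using (Bool; true; false; T; not; _∧_; _∨_)
open import Data.Unit using (tt)
open import Data.Sum using (inj₁; inj₂)
import Data.Sum as Sum
open import Data.Sum.Properties using (inj₁-injective; inj₂-injective)
open import Data.Product using (Σ; _×_; _,_; proj₁; proj₂)
open import Data.List using (length; filter; tabulate)
open import Data.Empty using (⊥-elim)
open import Relation.Nullary using (¬_)
open import Relation.Nullary.Decidable using (T?)
open import Function using (_∘_)
open import Function.Definitions using (Injective)
open import Relation.Binary.PropositionalEquality

𝟙 : Bool → ℕ
𝟙 true  = 1
𝟙 false = 0

𝟙≤1 : ∀ u → 𝟙 u ≤ 1
𝟙≤1 true  = s≤s z≤n
𝟙≤1 false = z≤n

count : ∀ {n} → (Fin n → Bool) → ℕ
count {n} p = ∑[ x < n ] 𝟙 (p x)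

∑-mono-≤ : ∀ {n} {f g : Fin n → ℕ} → (∀ x → f x ≤ g x) → sum f ≤ sum g
∑-mono-≤ {zero}  f≤g = z≤n
∑-mono-≤ {suc n} f≤g = +-mono-≤ (f≤g zero) (∑-mono-≤ (f≤g ∘ suc))

∑-ones : ∀ n → ∑[ x < n ] 1 ≡ n
∑-ones zero    = refl
∑-ones (suc n) = cong suc (∑-ones n)

-- The degree functions of Defs count by filtering a list; they agree with
-- count.  (allFin n is tabulate id, so we generalise to tabulate g.)
length-filter-tabulate : ∀ {A : Set} {n} (p : A → Bool) (g : Fin n → A) →
  length (filter (T? ∘ p) (tabulate g)) ≡ count (p ∘ g)
length-filter-tabulate {n = zero}  p g = refl
length-filter-tabulate {n = suc n} p g with p (g zero)
... | true  = cong suc (length-filter-tabulate p (g ∘ suc))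
... | false = length-filter-tabulate p (g ∘ suc)

degA≡count : ∀ G a → degA G a ≡ count (adj G a)
degA≡count G a = length-filter-tabulate (adj G a) (λ b → b)

degB≡count : ∀ G b → degB G b ≡ count (λ a → adj G a b)
degB≡count G b = length-filter-tabulate (λ a → adj G a b) (λ a → a)

𝟙-complement : ∀ u → 𝟙 u + 𝟙 (not u) ≡ 1
𝟙-complement true  = refl
𝟙-complement false = refl

count-complement : ∀ {n} (p : Fin n → Bool) → count p + count (not ∘ p) ≡ n
count-complement {n} p = begin
  count p + count (not ∘ p)             ≡⟨ ∑-distrib-+ (𝟙 ∘ p) (𝟙 ∘ not ∘ p) ⟨
  ∑[ x < n ] (𝟙 (p x) + 𝟙 (not (p x))) ≡⟨ sum-cong-≗ (𝟙-complement ∘ p) ⟩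
  ∑[ x < n ] 1                          ≡⟨ ∑-ones n ⟩
  n                                     ∎
  where open ≡-Reasoning

witness : ∀ {n} (p : Fin n → Bool) → 0 < count p → Σ (Fin n) (T ∘ p)
witness {suc n} p 0<count with p zero in p0
... | true  = zero , subst T (sym p0) tt
... | false = let x , px = witness (p ∘ suc) 0<count in suc x , px

count-punchIn : ∀ {n} (p : Fin (suc n) → Bool) x →
  count p ≤ suc (count (p ∘ punchIn x))
count-punchIn p x = begin
  count p                            ≡⟨ sum-remove {i = x} (𝟙 ∘ p) ⟩
  𝟙 (p x) + count (p ∘ punchIn x)    ≤⟨ +-monoˡ-≤ _ (𝟙≤1 (p x)) ⟩
  suc (count (p ∘ punchIn x))        ∎
  where open ≤-Reasoning

-- Choose any element
-- of the first set and recurse on the others with that element deleted.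
distinctRepresentatives : ∀ m {n} (c : Fin m → Fin n → Bool) →
  (∀ i → m ≤ count (c i)) →
  Σ (Fin m → Fin n) λ g → Injective _≡_ _≡_ g × (∀ i → T (c i (g i)))
distinctRepresentatives zero c large = (λ ()) , (λ { {()} }) , (λ ())
distinctRepresentatives (suc m) {zero} c large with () ← large zero
distinctRepresentatives (suc m) {suc n} c large = g , g-injective , g-represents
  where
  first : Σ (Fin (suc n)) (T ∘ c zero)
  first = witness (c zero) (≤-trans (s≤s z≤n) (large zero))

  x : Fin (suc n)
  x = proj₁ first

  c′ : Fin m → Fin n → Bool
  c′ i = c (suc i) ∘ punchIn x

  rest : Σ (Fin m → Fin n) λ g′ → Injective _≡_ _≡_ g′ × (∀ i → T (c′ i (g′ i)))
  rest = distinctRepresentatives m c′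
    (λ i → ≤-pred (≤-trans (large (suc i)) (count-punchIn (c (suc i)) x)))

  g′ : Fin m → Fin n
  g′ = proj₁ rest

  g : Fin (suc m) → Fin (suc n)
  g zero    = x
  g (suc i) = punchIn x (g′ i)

  g-injective : Injective _≡_ _≡_ g
  g-injective {zero}  {zero}  _  = refl
  g-injective {zero}  {suc j} eq = ⊥-elim (punchInᵢ≢i x (g′ j) (sym eq))
  g-injective {suc i} {zero}  eq = ⊥-elim (punchInᵢ≢i x (g′ i) eq)
  g-injective {suc i} {suc j} eq =
    cong suc (proj₁ (proj₂ rest) (punchIn-injective x (g′ i) (g′ j) eq))

  g-represents : ∀ i → T (c i (g i))
  g-represents zero    = proj₂ first
  g-represents (suc i) = proj₂ (proj₂ rest) i

some : ∀ {m} → (Fin m → Bool) → Bool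
some {zero}  p = false
some {suc m} p = p zero ∨ some (p ∘ suc)

𝟙-some≤count : ∀ {m} (p : Fin m → Bool) → 𝟙 (some p) ≤ count p
𝟙-some≤count {zero}  p = z≤n
𝟙-some≤count {suc m} p with p zero
... | true  = s≤s z≤n
... | false = 𝟙-some≤count (p ∘ suc)

¬some⇒¬T : ∀ {m} (p : Fin m → Bool) → ¬ T (some p) → ∀ i → ¬ T (p i)
¬some⇒¬T p ¬some i pi = ¬some (T-some p i pi)
  where
  T-some : ∀ {m} (p : Fin m → Bool) i → T (p i) → T (some p)
  T-some p zero pi with p zero
  ... | true = tt
  T-some p (suc i) pi with p zero
  ... | true  = tt
  ... | false = T-some (p ∘ suc) i pi

union-bound : ∀ {m n} (p : Fin m → Fin n → Bool) →
  count (λ y → some (λ i → p i y)) ≤ ∑[ i < m ] count (p i)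
union-bound {m} {n} p = begin
  count (λ y → some (λ i → p i y))     ≤⟨ ∑-mono-≤ (λ y → 𝟙-some≤count (λ i → p i y)) ⟩
  ∑[ y < n ] ∑[ i < m ] 𝟙 (p i y)      ≡⟨ ∑-comm (λ i y → 𝟙 (p i y)) ⟨
  ∑[ i < m ] count (p i)               ∎
  where open ≤-Reasoning

-- If d + e = n and (D-1)n ≤ Dd, then De ≤ n: a vertex of degree at least
-- (1 - 1/D)n has at most n/D non-neighbours.
complement-bound : ∀ D {d e n} → d + e ≡ n → (D ∸ 1) * n ≤ D * d → D * e ≤ n
complement-bound zero     _     _     = z≤n
complement-bound (suc D′) {d} {e} {n} d+e≡n dense =
  +-cancelʳ-≤ (suc D′ * d) (suc D′ * e) n (begin
    suc D′ * e + suc D′ * d ≡⟨ +-comm (suc D′ * e) _ ⟩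
    suc D′ * d + suc D′ * e ≡⟨ *-distribˡ-+ (suc D′) d e ⟨
    suc D′ * (d + e)        ≡⟨ cong (suc D′ *_) d+e≡n ⟩
    n + D′ * n              ≤⟨ +-monoʳ-≤ n dense ⟩
    n + suc D′ * d          ∎)
  where open ≤-Reasoning

half-bound : ∀ {c k m n} → c + k ≡ n → 2 * c ≤ n → 2 * m ≤ n → m ≤ k
half-bound {c} {k} {m} {n} c+k≡n 2c≤n 2m≤n =
  +-cancelˡ-≤ c m k (*-cancelˡ-≤ 2 (begin
    2 * (c + m)     ≡⟨ *-distribˡ-+ 2 c m ⟩
    2 * c + 2 * m   ≤⟨ +-mono-≤ 2c≤n 2m≤n ⟩
    n + n           ≡⟨ cong (n +_) (+-identityʳ n) ⟨
    2 * n           ≡⟨ cong (2 *_) c+k≡n ⟨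
    2 * (c + k)     ∎))
  where open ≤-Reasoning

count-∧ : ∀ {n} u (q : Fin n → Bool) → count (λ y → u ∧ q y) ≡ 𝟙 u * count q
count-∧ true  q = sym (+-identityʳ (count q))
count-∧ {n} false q = ∑-zero n
  where
  ∑-zero : ∀ n → ∑[ y < n ] 0 ≡ 0
  ∑-zero zero    = refl
  ∑-zero (suc n) = ∑-zero n

weighted-count-bound : ∀ {m} D N (p : Fin m → Bool) (w : Fin m → ℕ) →
  (∀ i → D * w i ≤ N) → D * ∑[ i < m ] (𝟙 (p i) * w i) ≤ count p * N
weighted-count-bound {zero}  D N p w small = ≤-reflexive (*-zeroʳ D)
weighted-count-bound {suc m} D N p w small = begin
  D * (𝟙 (p zero) * w zero + rest)     ≡⟨ *-distribˡ-+ D _ rest ⟩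
  D * (𝟙 (p zero) * w zero) + D * rest
    ≤⟨ +-mono-≤ (single (p zero)) (weighted-count-bound D N (p ∘ suc) (w ∘ suc) (small ∘ suc)) ⟩
  𝟙 (p zero) * N + count (p ∘ suc) * N ≡⟨ *-distribʳ-+ N (𝟙 (p zero)) _ ⟨
  count p * N                          ∎
  where
  open ≤-Reasoning
  rest : ℕ
  rest = ∑[ i < m ] (𝟙 (p (suc i)) * w (suc i))
  single : ∀ u → D * (𝟙 u * w zero) ≤ 𝟙 u * N
  single true rewrite +-identityʳ (w zero) | +-identityʳ N = small zero
  single false = ≤-reflexive (*-zeroʳ D)

module Conflicts (H G : BipGraph) (φ : Fin (nA H) → Fin (nA G)) where

  conflict : Fin (nB H) → Fin (nB G) → Bool
  conflict b y = some (λ a → adj H a b ∧ not (adj G (φ a) y))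

  free-adjacent : ∀ {a b y} → T (not (conflict b y)) → T (adj H a b) →
    T (adj G (φ a) y)
  free-adjacent {a} {b} {y} free ab with adj G (φ a) y in a′y
  ... | true  = tt
  ... | false = ⊥-elim (¬some⇒¬T _ (T-not⇒¬T free) a (T-∧-not ab a′y))
    where
    T-not⇒¬T : ∀ {u} → T (not u) → ¬ T u
    T-not⇒¬T {false} _ ()
    T-∧-not : ∀ {u v} → T u → v ≡ false → T (u ∧ not v)
    T-∧-not {true} _ refl = tt

  -- Each b has at most |B'|/2 conflicts: b has at most Δ neighbours a, and
  -- each φ(a) has at most |B'|/(2Δ) non-neighbours.
  conflict-bound : ∀ Δ .{{_ : NonZero Δ}} b → degB H b ≤ Δ →
    (∀ a′ → (2 * Δ ∸ 1) * nB G ≤ 2 * Δ * degA G a′) →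
    2 * count (conflict b) ≤ nB G
  conflict-bound Δ b deg≤Δ dense = *-cancelˡ-≤ Δ (begin
    Δ * (2 * count (conflict b))                       ≡⟨ *-assoc Δ 2 _ ⟨
    Δ * 2 * count (conflict b)                         ≡⟨ cong (_* count (conflict b)) (*-comm Δ 2) ⟩
    2 * Δ * count (conflict b)                         ≤⟨ *-monoʳ-≤ (2 * Δ) (union-bound missing) ⟩
    2 * Δ * ∑[ a < nA H ] count (missing a)            ≡⟨ cong (2 * Δ *_) (sum-cong-≗ (λ a → count-∧ (adj H a b) (not ∘ adj G (φ a)))) ⟩
    2 * Δ * ∑[ a < nA H ] (𝟙 (adj H a b) * nonDeg a)   ≤⟨ weighted-count-bound (2 * Δ) (nB G) (λ a → adj H a b) nonDeg few-non-neighbours ⟩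
    count (λ a → adj H a b) * nB G                     ≡⟨ cong (_* nB G) (degB≡count H b) ⟨
    degB H b * nB G                                    ≤⟨ *-monoˡ-≤ (nB G) deg≤Δ ⟩
    Δ * nB G                                           ∎)
    where
    open ≤-Reasoning
    missing : Fin (nA H) → Fin (nB G) → Bool
    missing a y = adj H a b ∧ not (adj G (φ a) y)
    nonDeg : Fin (nA H) → ℕ
    nonDeg a = count (not ∘ adj G (φ a))
    few-non-neighbours : ∀ a → 2 * Δ * nonDeg a ≤ nB G
    few-non-neighbours a = complement-bound (2 * Δ) (count-complement (adj G (φ a)))
      (subst (λ d → (2 * Δ ∸ 1) * nB G ≤ 2 * Δ * d) (degA≡count G (φ a)) (dense (φ a)))

  many-candidates : ∀ Δ .{{_ : NonZero Δ}} b → degB H b ≤ Δ →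
    (∀ a′ → (2 * Δ ∸ 1) * nB G ≤ 2 * Δ * degA G a′) →
    2 * nB H ≤ nB G → nB H ≤ count (not ∘ conflict b)
  many-candidates Δ b deg≤Δ dense 2|B|≤|B′| =
    half-bound (count-complement (conflict b)) (conflict-bound Δ b deg≤Δ dense) 2|B|≤|B′|

⊎-map-injective : ∀ {A B C D : Set} {f : A → C} {g : B → D} →
  Injective _≡_ _≡_ f → Injective _≡_ _≡_ g → Injective _≡_ _≡_ (Sum.map f g)
⊎-map-injective f-inj g-inj {inj₁ x} {inj₁ y} eq = cong inj₁ (f-inj (inj₁-injective eq))
⊎-map-injective f-inj g-inj {inj₂ x} {inj₂ y} eq = cong inj₂ (g-inj (inj₂-injective eq))

lemma8 : (H G : BipGraph) (Δ : ℕ) → 1 ≤ Δ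
    → (∀ b → degB H b ≤ Δ)
    → (∀ a' → (2 * Δ ∸ 1) * nB G ≤ 2 * Δ * degA G a')
    → 2 * nB H ≤ nB G
    → (φ : Fin (nA H) → Fin (nA G)) → Injective _≡_ _≡_ φ
    → Σ (Vertex H → Vertex G) λ ψ →
        Injective _≡_ _≡_ ψ
        × (∀ a → ψ (inj₁ a) ≡ inj₁ (φ a))
        × (∀ b → Σ (Fin (nB G)) λ b' → ψ (inj₂ b) ≡ inj₂ b')
        × (∀ a b → T (adj H a b) → Σ (Fin (nA G)) λ a' → Σ (Fin (nB G)) λ b' →
             ψ (inj₁ a) ≡ inj₁ a' × ψ (inj₂ b) ≡ inj₂ b' × T (adj G a' b'))
lemma8 H G Δ 1≤Δ sparse dense 2|B|≤|B′| φ φ-injective =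
  Sum.map φ g , ⊎-map-injective φ-injective g-injective ,
  (λ a → refl) , (λ b → g b , refl) ,
  (λ a b ab → φ a , g b , refl , refl , free-adjacent (g-free b) ab)
  where
  open Conflicts H G φ
  instance
    Δ-nonZero : NonZero Δ
    Δ-nonZero = >-nonZero 1≤Δ

  images : Σ (Fin (nB H) → Fin (nB G)) λ g →
             Injective _≡_ _≡_ g × (∀ b → T (not (conflict b (g b))))
  images = distinctRepresentatives (nB H) (λ b → not ∘ conflict b)
             (λ b → many-candidates Δ b (sparse b) dense 2|B|≤|B′|)

  g : Fin (nB H) → Fin (nB G)
  g = proj₁ images

  g-injective : Injective _≡_ _≡_ g
  g-injective = proj₁ (proj₂ images)

  g-free : ∀ b → T (not (conflict b (g b)))
  g-free = proj₂ (proj₂ images)
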